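{- In Gödel's sequent system $\mathcal{G}$, the structural rule of permutation is derivable: for all formulas $P,Q,R$ and finite sequences of formulas $\Delta,\Gamma$, if $\Delta,P,Q,\Gamma\rightarrow R$ is provable in $\mathcal{G}$, then $\Delta,Q,P,\Gamma\rightarrow R$ is provable in $\mathcal{G}$.
   Context: Formulas are built from propositional letters with the connectives $\sim$ (negation) and $\supset$ (implication). A sequent has the form $\Delta\rightarrow P$, where $\Delta$ is a finite, possibly empty, sequence of formulas and $P$ is a formula. Gödel's system $\mathcal{G}$ has as axioms all sequents $P\rightarrow P$, and the rules: thinning: from $\Delta\rightarrow Q$ infer $P,\Delta\rightarrow Q$, and from $\Delta\rightarrow Q$ infer $\Delta,P\rightarrow Q$; implication introduction: from $\Delta,P\rightarrow Q$ infer $\Delta\rightarrow P\supset Q$; implication elimination: from $\Delta\rightarrow P$ and $\Delta\rightarrow P\supset Q$ infer $\Delta\rightarrow Q$; reductio ad absurdum: from $\Delta,\sim P\rightarrow Q$ and $\Delta,\sim P\rightarrow\,\sim Q$ infer $\Delta\rightarrow P$. A sequent is provable if it is obtained from axioms by finitely many rule applications. -}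

module Defs where

open import Data.Nat using (ℕ)
open import Data.List using (List; []; _∷_; _++_; [_])

data Formula : Set where
  var  : ℕ → Formula
  ~_   : Formula → Formula
  _⊃_  : Formula → Formula → Formula

infix  30 ~_
infixr 20 _⊃_

-- A sequent Δ → P : Δ is a finite sequence (list) of formulas.
-- Provable Δ P  means  "Δ → P" is provable in Gödel's system 𝒢.
-- "Δ , P" is written  Δ ++ [ P ].
data Provable : List Formula → Formula → Set where
  axiom    : (P : Formula) → Provable [ P ] P
  thinL    : {Δ : List Formula} {Q : Formula} (P : Formula) →
             Provable Δ Q → Provable (P ∷ Δ) Q
  thinR    : {Δ : List Formula} {Q : Formula} (P : Formula) →
             Provable Δ Q → Provable (Δ ++ [ P ]) Q
  ⊃-intro  : {Δ : List Formula} {P Q : Formula} →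
             Provable (Δ ++ [ P ]) Q → Provable Δ (P ⊃ Q)
  ⊃-elim   : {Δ : List Formula} {P Q : Formula} →
             Provable Δ P → Provable Δ (P ⊃ Q) → Provable Δ Q
  reductio : {Δ : List Formula} {P Q : Formula} →
             Provable (Δ ++ [ ~ P ]) Q → Provable (Δ ++ [ ~ P ]) (~ Q) →
             Provable Δ P

-- A sequent Δ , Γ → R is interderivable with Δ → Γ ⊃* R, where Γ ⊃* R
-- curries the formulas of Γ into R (implication introduction one way,
-- implication elimination against an assumption the other way).  Permuting
-- P and Q in the antecedent therefore amounts to deriving Q ⊃ P ⊃ C from
-- P ⊃ Q ⊃ C over Δ, which is immediate once Q and P are assumed.
module Submission where

open import Defs
open import Data.List using (List; []; _∷_; _++_; [_]; foldr)
open import Data.List.Properties using (++-assoc; ++-identityʳ)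
open import Relation.Binary.PropositionalEquality using (_≡_; sym; subst)

infixr 20 _⊃*_

_⊃*_ : List Formula → Formula → Formula
Γ ⊃* R = foldr _⊃_ R Γ

Provable-resp : {Δ Δ′ : List Formula} {R : Formula} →
                Δ ≡ Δ′ → Provable Δ R → Provable Δ′ R
Provable-resp {R = R} = subst (λ Δ → Provable Δ R)

thinL* : (Θ : List Formula) {Δ : List Formula} {R : Formula} →
         Provable Δ R → Provable (Θ ++ Δ) R
thinL* []      p = p
thinL* (X ∷ Θ) p = thinL X (thinL* Θ p)

assumption-last : (Θ : List Formula) (A : Formula) → Provable (Θ ++ [ A ]) A
assumption-last Θ A = thinL* Θ (axiom A)

⊃-intro⁻¹ : {Θ : List Formula} {A B : Formula} →
            Provable Θ (A ⊃ B) → Provable (Θ ++ [ A ]) B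
⊃-intro⁻¹ {Θ} {A} p = ⊃-elim (assumption-last Θ A) (thinR A p)

⊃*-intro : (Θ Γ : List Formula) {R : Formula} →
           Provable (Θ ++ Γ) R → Provable Θ (Γ ⊃* R)
⊃*-intro Θ []      p = Provable-resp (++-identityʳ Θ) p
⊃*-intro Θ (A ∷ Γ) p =
  ⊃-intro (⊃*-intro (Θ ++ [ A ]) Γ (Provable-resp (sym (++-assoc Θ [ A ] Γ)) p))

⊃*-elim : (Θ Γ : List Formula) {R : Formula} →
          Provable Θ (Γ ⊃* R) → Provable (Θ ++ Γ) R
⊃*-elim Θ []      p = Provable-resp (sym (++-identityʳ Θ)) p
⊃*-elim Θ (A ∷ Γ) p =
  Provable-resp (++-assoc Θ [ A ] Γ) (⊃*-elim (Θ ++ [ A ]) Γ (⊃-intro⁻¹ p))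

⊃-exchange : {Δ : List Formula} {P Q C : Formula} →
             Provable Δ (P ⊃ Q ⊃ C) → Provable Δ (Q ⊃ P ⊃ C)
⊃-exchange {Δ} {P} {Q} p =
  ⊃-intro (⊃-intro (⊃-elim (thinR P (assumption-last Δ Q)) (⊃-intro⁻¹ (thinR Q p))))

mainTheorem2 : (P Q R : Formula) (Δ Γ : List Formula) →
    Provable (Δ ++ (P ∷ Q ∷ Γ)) R → Provable (Δ ++ (Q ∷ P ∷ Γ)) R
mainTheorem2 P Q R Δ Γ p =
  ⊃*-elim Δ (Q ∷ P ∷ Γ) (⊃-exchange (⊃*-intro Δ (P ∷ Q ∷ Γ) p))
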